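{- For $N\ge 0$ let $a_N$ be the number of tilings of the $3\times 3\times \tfrac{2N}{3}$ box by $1\times2\times 3$ bricks when $2N/3$ is a positive integer, $a_N=0$ when $2N/3$ is not an integer, and $a_0=1$. Then $$\sum_{N\ge 0} a_N z^N=\frac{1-z^3}{1-7z^3-22z^6-36z^9}=1+6z^3+64z^6+616z^9+5936z^{12}+\cdots.$$
   Context: A tiling of a $k\times m\times n$ box (made of $kmn$ unit cubes) by $t_1\times t_2\times t_3$ bricks is a set of non-overlapping axis-parallel boxes with integer corners, each congruent to the brick (i.e. of dimensions some permutation of $(t_1,t_2,t_3)$; all orientations may be mixed), whose union is the box. Tilings related by a symmetry of the box are counted separately. $N$ is the number of bricks used. -}

module Defs where

open import Data.Nat using (ℕ; zero; suc; _+_; _*_; _∸_; _≤_; _<_)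
open import Data.Integer as ℤ using (ℤ)
open import Data.List using (List; []; _∷_; map; upTo; foldr; length)
open import Data.List.Relation.Unary.All using (All)
open import Data.List.Relation.Unary.Any using (Any)
open import Data.List.Relation.Unary.AllPairs using (AllPairs)
open import Data.List.Relation.Unary.Unique.Propositional using (Unique)
open import Data.List.Membership.Propositional using (_∈_)
open import Data.List.Relation.Binary.Permutation.Propositional using (_↭_)
open import Data.Product using (_×_; ∃; ∃-syntax; _,_)
open import Relation.Binary.PropositionalEquality using (_≡_)
open import Relation.Nullary using (¬_)
open import Function.Bundles using (_⇔_)

HasCount : {A : Set} → (A → Set) → ℕ → Set
HasCount {A} P a =
  ∃[ xs ] (Unique xs × length xs ≡ a × ((x : A) → P x ⇔ (x ∈ xs)))

record Cuboid : Set where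
  constructor cuboid
  field
    x y z dx dy dz : ℕ
open Cuboid public

-- the unit cube with lower corner (i , j , l) lies in the cuboid c
_∈ᶜ_ : ℕ × ℕ × ℕ → Cuboid → Set
(i , j , l) ∈ᶜ c =
  (x c ≤ i × i < x c + dx c) ×
  (y c ≤ j × j < y c + dy c) ×
  (z c ≤ l × l < z c + dz c)

Disjoint : Cuboid → Cuboid → Set
Disjoint c d = ¬ (∃[ p ] (p ∈ᶜ c × p ∈ᶜ d))

InsideBox : ℕ → ℕ → ℕ → Cuboid → Set
InsideBox k m n c = (x c + dx c ≤ k) × (y c + dy c ≤ m) × (z c + dz c ≤ n)

CongruentTo : ℕ → ℕ → ℕ → Cuboid → Set
CongruentTo t₁ t₂ t₃ c = (dx c ∷ dy c ∷ dz c ∷ []) ↭ (t₁ ∷ t₂ ∷ t₃ ∷ [])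

-- strict lexicographic order on lists of naturals, used to represent a
-- finite SET of cuboids canonically as a strictly increasing list
data _<ˡ_ : List ℕ → List ℕ → Set where
  here  : ∀ {a b as bs} → a < b → (a ∷ as) <ˡ (b ∷ bs)
  there : ∀ {a as bs} → as <ˡ bs → (a ∷ as) <ˡ (a ∷ bs)

key : Cuboid → List ℕ
key c = x c ∷ y c ∷ z c ∷ dx c ∷ dy c ∷ dz c ∷ []

_<ᶜ_ : Cuboid → Cuboid → Set
c <ᶜ d = key c <ˡ key d

-- A tiling of the k × m × n box by t₁ × t₂ × t₃ bricks, represented as
-- the strictly increasing list of its bricks (so each set of bricks has
-- exactly one representation).
IsTiling : ℕ → ℕ → ℕ → ℕ → ℕ → ℕ → List Cuboid → Set
IsTiling k m n t₁ t₂ t₃ T =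
  AllPairs _<ᶜ_ T ×
  All (CongruentTo t₁ t₂ t₃) T ×
  All (InsideBox k m n) T ×
  AllPairs Disjoint T ×
  ((i j l : ℕ) → i < k → j < m → l < n → Any ((i , j , l) ∈ᶜ_) T)

NumTilings : ℕ → ℕ → ℕ → ℕ → ℕ → ℕ → ℕ → Set
NumTilings k m n t₁ t₂ t₃ a = HasCount (IsTiling k m n t₁ t₂ t₃) a

Series : Set
Series = ℕ → ℤ

sumℤ : List ℤ → ℤ
sumℤ = foldr ℤ._+_ (ℤ.+ 0)

_⋆_ : Series → Series → Series
(f ⋆ g) n = sumℤ (map (λ i → f i ℤ.* g (n ∸ i)) (upTo (suc n)))

-- polynomial with the given coefficient list (constant term first)
poly : List ℤ → Series
poly []       _       = ℤ.+ 0
poly (c ∷ cs) zero    = c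
poly (c ∷ cs) (suc n) = poly cs n

ofℕ : (ℕ → ℕ) → Series
ofℕ a n = ℤ.+ (a n)

-- Slice the 3 × 3 × L box into horizontal layers. A brick is at most 3 long, so the
-- bricks lying on the floor reach at most two layers higher. Hence a tiling of the
-- box in which some cells s of the two lowest layers are already filled splits into
-- a set C of floor bricks, covering the rest of the floor, and a tiling of the box
-- one layer lower in which the cells above the floor filled by s or C are filled:
-- tilingCount (L + 1) s is the sum of tilingCount L (next s C) over all such C.
-- Only 18 states are reachable from the empty one, and in this transfer graph the
-- multiset of end points of the walks of length 6 from the empty state is 7 copies
-- of those of length 4, 22 of length 2 and 36 of length 0. This gives
-- t (L + 6) = 7 t (L + 4) + 22 t (L + 2) + 36 t L for the number t L of tilings,
-- i.e. the denominator, and the initial values 1, 6, 64 give the numerator.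

module Submission where

open import Defs
open import Data.Nat using (ℕ; zero; suc; pred; s<s⁻¹; _+_; _*_; _∸_; _⊔_; _⊓_; _≤_; _<_; _≤?_; _<?_; _≟_; z≤n; s≤s; z<s; s<s)
open import Data.Nat.Properties
open import Data.Nat.Divisibility using (_∣_; _∣?_; divides; ∣m+n∣m⇒∣n)
open import Data.Nat.ListAction using (sum)
open import Data.Nat.ListAction.Properties using (sum-++; sum-↭)
open import Data.Integer as ℤ using (ℤ; +_; -_)
import Data.Integer.Properties as ℤ
open import Data.Integer.Solver using (module +-*-Solver)
open import Data.Bool using (T)
open import Data.Bool.ListAction using (all)
open import Data.Unit using (tt)
open import Data.Maybe using (fromMaybe)
open import Data.Product using (_×_; _,_; ∃-syntax; proj₁; proj₂)
open import Data.Product.Properties using () renaming (≡-dec to ×-≡-dec)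
open import Data.Sum using (_⊎_; inj₁; inj₂) renaming ([_,_] to either)
open import Data.List using (List; []; _∷_; _++_; [_]; length; foldr; map; concat; concatMap; replicate; head; drop; upTo; applyUpTo; cartesianProduct; filter)
open import Data.List.Properties using (length-++; length-map; map-++; map-∘; map-cong; map-cong-local; applyUpTo-∷ʳ; ∷-injectiveʳ; ≡-dec)
open import Data.List.Relation.Unary.All as All using (All; []; _∷_)
import Data.List.Relation.Unary.All.Properties as All
open import Data.List.Relation.Unary.Any as Any using (Any; here; there)
open import Data.List.Relation.Unary.AllPairs as AllPairs using (AllPairs; []; _∷_)
import Data.List.Relation.Unary.AllPairs.Properties as AllPairs
open import Data.List.Relation.Unary.Unique.Propositional using (Unique)
import Data.List.Relation.Unary.Unique.Propositional.Properties as Unique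
open import Data.List.Relation.Unary.Linked using (_∷_; [-])
open import Data.List.Relation.Unary.Sorted.TotalOrder using () renaming (Sorted to Sorted≤)
open import Data.List.Relation.Unary.Sorted.TotalOrder.Properties using (↗↭↗⇒≋)
open import Data.List.Membership.Propositional using (_∈_; _∉_; find; lose)
open import Data.List.Membership.Propositional.Properties
open import Data.List.Relation.Binary.Subset.Propositional using (_⊆_)
open import Data.List.Relation.Binary.Permutation.Propositional using (_↭_; ↭-sym; ↭-trans; ↭⇒↭ₛ)
open import Data.List.Relation.Binary.Permutation.Propositional.Properties as ↭ using (∈-resp-↭)
open import Data.List.Relation.Binary.Pointwise using (Pointwise-≡⇒≡)
open import Data.List.Sort.Base using (module SortingAlgorithm)
open import Data.List.Sort.MergeSort ≤-decTotalOrder using (mergeSort)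
open import Function.Base using (_∘_; _∘′_)
open import Function.Bundles using (_⇔_; mk⇔; Equivalence)
open import Relation.Binary using (tri<; tri≈; tri>)
open import Relation.Binary.Definitions using (DecidableEquality)
open import Relation.Binary.PropositionalEquality using (_≡_; _≢_; refl; sym; trans; cong; cong₂; subst; subst₂; module ≡-Reasoning)
open import Relation.Nullary using (¬_; Dec; yes; no; contradiction; ¬?; _×-dec_; _⊎-dec_)
open import Relation.Nullary.Decidable using (True; isYes; map′; toWitness)

private variable A B : Set

<ˡ-trans : ∀ {as bs cs} → as <ˡ bs → bs <ˡ cs → as <ˡ cs
<ˡ-trans (here p)  (here q)  = here (<-trans p q)
<ˡ-trans (here p)  (there _) = here p
<ˡ-trans (there _) (here q)  = here q
<ˡ-trans (there p) (there q) = there (<ˡ-trans p q)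

<ˡ-irrefl : ∀ {as} → ¬ (as <ˡ as)
<ˡ-irrefl (here p)  = <-irrefl refl p
<ˡ-irrefl (there p) = <ˡ-irrefl p

<ˡ-cmp : ∀ as bs → length as ≡ length bs → as <ˡ bs ⊎ as ≡ bs ⊎ bs <ˡ as
<ˡ-cmp []       []       _ = inj₂ (inj₁ refl)
<ˡ-cmp (a ∷ as) (b ∷ bs) e with <-cmp a b
... | tri< a<b _ _ = inj₁ (here a<b)
... | tri> _ _ b<a = inj₂ (inj₂ (here b<a))
... | tri≈ _ refl _ with <ˡ-cmp as bs (suc-injective e)
...   | inj₁ p        = inj₁ (there p)
...   | inj₂ (inj₁ q) = inj₂ (inj₁ (cong (a ∷_) q))
...   | inj₂ (inj₂ p) = inj₂ (inj₂ (there p))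

<ˡ? : ∀ as bs → Dec (as <ˡ bs)
<ˡ? []       _        = no λ ()
<ˡ? (_ ∷ _)  []       = no λ ()
<ˡ? (a ∷ as) (b ∷ bs) with <-cmp a b
... | tri< a<b _ _ = yes (here a<b)
... | tri> a≮b a≢b _ = no λ { (here a<b) → a≮b a<b ; (there _) → a≢b refl }
... | tri≈ a≮b refl _ with <ˡ? as bs
...   | yes p = yes (there p)
...   | no ¬p = no λ { (here a<b) → a≮b a<b ; (there p) → ¬p p }

key-injective : ∀ {c d} → key c ≡ key d → c ≡ d
key-injective {cuboid _ _ _ _ _ _} {cuboid _ _ _ _ _ _} refl = refl

<ᶜ-trans : ∀ {c d e} → c <ᶜ d → d <ᶜ e → c <ᶜ e
<ᶜ-trans = <ˡ-trans

<ᶜ-irrefl : ∀ {c} → ¬ (c <ᶜ c)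
<ᶜ-irrefl = <ˡ-irrefl

<ᶜ-cmp : ∀ c d → c <ᶜ d ⊎ c ≡ d ⊎ d <ᶜ c
<ᶜ-cmp c d with <ˡ-cmp (key c) (key d) refl
... | inj₁ p        = inj₁ p
... | inj₂ (inj₁ e) = inj₂ (inj₁ (key-injective e))
... | inj₂ (inj₂ p) = inj₂ (inj₂ p)

_<ᶜ?_ : ∀ c d → Dec (c <ᶜ d)
c <ᶜ? d = <ˡ? (key c) (key d)

<ᶜ⇒≢ : ∀ {c d} → c <ᶜ d → c ≢ d
<ᶜ⇒≢ c<d refl = <ᶜ-irrefl c<d

Sorted : List Cuboid → Set
Sorted = AllPairs _<ᶜ_

Sorted-≡ : ∀ {cs ds} → Sorted cs → Sorted ds → cs ⊆ ds → ds ⊆ cs → cs ≡ ds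
Sorted-≡ {[]}     {[]}     _ _ _ _ = refl
Sorted-≡ {[]}     {d ∷ _}  _ _ _ ds⊆cs with () ← ds⊆cs (here refl)
Sorted-≡ {c ∷ _}  {[]}     _ _ cs⊆ds _ with () ← cs⊆ds (here refl)
Sorted-≡ {c ∷ cs} {d ∷ ds} (c< ∷ scs) (d< ∷ sds) cs⊆ds ds⊆cs with cs⊆ds (here refl) | ds⊆cs (here refl)
... | here refl | _ = cong (c ∷_) (Sorted-≡ scs sds (tail c< cs⊆ds) (tail d< ds⊆cs))
  where
  tail : ∀ {x xs ys} → All (x <ᶜ_) xs → (x ∷ xs) ⊆ (x ∷ ys) → xs ⊆ ys
  tail x< sub e∈ with sub (there e∈)
  ... | here refl = contradiction (All.lookup x< e∈) <ᶜ-irrefl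
  ... | there e∈′ = e∈′
... | there c∈ds | here refl = contradiction (All.lookup d< c∈ds) <ᶜ-irrefl
... | there c∈ds | there d∈cs = contradiction (<ᶜ-trans (All.lookup d< c∈ds) (All.lookup c< d∈cs)) <ᶜ-irrefl

Sorted⇒AllPairs : ∀ {R : Cuboid → Cuboid → Set} {cs} → Sorted cs →
                  (∀ {c d} → c ∈ cs → d ∈ cs → c <ᶜ d → R c d) → AllPairs R cs
Sorted⇒AllPairs []         _ = []
Sorted⇒AllPairs (c< ∷ scs) R< =
  All.tabulate (λ d∈ → R< (here refl) (there d∈) (All.lookup c< d∈)) ∷
  Sorted⇒AllPairs scs (λ c∈ d∈ → R< (there c∈) (there d∈))

insert : Cuboid → List Cuboid → List Cuboid
insert c []       = [ c ]
insert c (d ∷ ds) with <ᶜ-cmp c d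
... | inj₁ _        = c ∷ d ∷ ds
... | inj₂ (inj₁ _) = d ∷ ds
... | inj₂ (inj₂ _) = d ∷ insert c ds

∈-insert⁻ : ∀ {e} c ds → e ∈ insert c ds → e ≡ c ⊎ e ∈ ds
∈-insert⁻ c []       (here e≡c) = inj₁ e≡c
∈-insert⁻ c (d ∷ ds) e∈ with <ᶜ-cmp c d
∈-insert⁻ c (d ∷ ds) (here e≡c)  | inj₁ _ = inj₁ e≡c
∈-insert⁻ c (d ∷ ds) (there e∈′) | inj₁ _ = inj₂ e∈′
... | inj₂ (inj₁ _) = inj₂ e∈
∈-insert⁻ c (d ∷ ds) (here e≡d)  | inj₂ (inj₂ _) = inj₂ (here e≡d)
∈-insert⁻ c (d ∷ ds) (there e∈′) | inj₂ (inj₂ _) with ∈-insert⁻ c ds e∈′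
... | inj₁ e≡c  = inj₁ e≡c
... | inj₂ e∈ds = inj₂ (there e∈ds)

∈-insert⁺ : ∀ {e} c ds → e ≡ c ⊎ e ∈ ds → e ∈ insert c ds
∈-insert⁺ c []       (inj₁ e≡c) = here e≡c
∈-insert⁺ c (d ∷ ds) e∈ with <ᶜ-cmp c d | e∈
... | inj₁ _          | inj₁ e≡c         = here e≡c
... | inj₁ _          | inj₂ e∈ds        = there e∈ds
... | inj₂ (inj₁ c≡d) | inj₁ refl        = here c≡d
... | inj₂ (inj₁ _)   | inj₂ e∈ds        = e∈ds
... | inj₂ (inj₂ _)   | inj₁ e≡c         = there (∈-insert⁺ c ds (inj₁ e≡c))
... | inj₂ (inj₂ _)   | inj₂ (here e≡d)  = here e≡d
... | inj₂ (inj₂ _)   | inj₂ (there e∈′) = there (∈-insert⁺ c ds (inj₂ e∈′))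

insert-sorted : ∀ c ds → Sorted ds → Sorted (insert c ds)
insert-sorted c []       _            = [] ∷ []
insert-sorted c (d ∷ ds) (d< ∷ sds) with <ᶜ-cmp c d
... | inj₁ c<d      = (c<d ∷ All.map (<ᶜ-trans c<d) d<) ∷ d< ∷ sds
... | inj₂ (inj₁ _) = d< ∷ sds
... | inj₂ (inj₂ d<c) = All.tabulate d<insert ∷ insert-sorted c ds sds
  where
  d<insert : ∀ {e} → e ∈ insert c ds → d <ᶜ e
  d<insert e∈ with ∈-insert⁻ c ds e∈
  ... | inj₁ refl = d<c
  ... | inj₂ e∈ds = All.lookup d< e∈ds

insertAll : List Cuboid → List Cuboid → List Cuboid
insertAll cs ds = foldr insert ds cs

∈-insertAll⁻ : ∀ {e} cs ds → e ∈ insertAll cs ds → e ∈ cs ⊎ e ∈ ds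
∈-insertAll⁻ []       ds e∈ = inj₂ e∈
∈-insertAll⁻ (c ∷ cs) ds e∈ with ∈-insert⁻ c (insertAll cs ds) e∈
... | inj₁ refl = inj₁ (here refl)
... | inj₂ e∈′ with ∈-insertAll⁻ cs ds e∈′
...   | inj₁ e∈cs = inj₁ (there e∈cs)
...   | inj₂ e∈ds = inj₂ e∈ds

∈-insertAll⁺ˡ : ∀ {e} cs ds → e ∈ cs → e ∈ insertAll cs ds
∈-insertAll⁺ˡ (c ∷ cs) ds (here e≡c)  = ∈-insert⁺ c (insertAll cs ds) (inj₁ e≡c)
∈-insertAll⁺ˡ (c ∷ cs) ds (there e∈cs) = ∈-insert⁺ c (insertAll cs ds) (inj₂ (∈-insertAll⁺ˡ cs ds e∈cs))

∈-insertAll⁺ʳ : ∀ {e} cs ds → e ∈ ds → e ∈ insertAll cs ds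
∈-insertAll⁺ʳ []       ds e∈ = e∈
∈-insertAll⁺ʳ (c ∷ cs) ds e∈ = ∈-insert⁺ c (insertAll cs ds) (inj₂ (∈-insertAll⁺ʳ cs ds e∈))

insertAll-sorted : ∀ cs ds → Sorted ds → Sorted (insertAll cs ds)
insertAll-sorted []       ds sds = sds
insertAll-sorted (c ∷ cs) ds sds = insert-sorted c (insertAll cs ds) (insertAll-sorted cs ds sds)

length-≤-of-⊆ : {xs ys : List A} → Unique xs → xs ⊆ ys → length xs ≤ length ys
length-≤-of-⊆ {xs = []}     _          _ = z≤n
length-≤-of-⊆ {xs = x ∷ xs} (x∉ ∷ uxs) x∷xs⊆ys with us , vs , refl ← ∈-∃++ (x∷xs⊆ys (here refl)) =
  subst (suc (length xs) ≤_) (sym length-split) (s≤s (length-≤-of-⊆ uxs xs⊆us++vs))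
  where
  xs⊆us++vs : xs ⊆ us ++ vs
  xs⊆us++vs e∈ with ∈-++⁻ us (x∷xs⊆ys (there e∈))
  ... | inj₁ e∈us = ∈-++⁺ˡ e∈us
  ... | inj₂ (here refl) = contradiction refl (All.lookup x∉ e∈)
  ... | inj₂ (there e∈vs) = ∈-++⁺ʳ us e∈vs
  length-split : length (us ++ x ∷ vs) ≡ suc (length (us ++ vs))
  length-split = trans (length-++ us) (trans (+-suc (length us) (length vs)) (cong suc (sym (length-++ us))))

HasCount-unique : ∀ {P : A → Set} {a b} → HasCount P a → HasCount P b → a ≡ b
HasCount-unique (xs , uxs , refl , xs⇔) (ys , uys , refl , ys⇔) =
  ≤-antisym (length-≤-of-⊆ uxs λ e∈ → Equivalence.to (ys⇔ _) (Equivalence.from (xs⇔ _) e∈))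
            (length-≤-of-⊆ uys λ e∈ → Equivalence.to (xs⇔ _) (Equivalence.from (ys⇔ _) e∈))

HasCount-resp-⇔ : ∀ {P Q : A → Set} {a} → (∀ x → P x ⇔ Q x) → HasCount P a → HasCount Q a
HasCount-resp-⇔ P⇔Q (xs , uxs , len , xs⇔) =
  xs , uxs , len , λ x → mk⇔ (Equivalence.to (xs⇔ x) ∘′ Equivalence.from (P⇔Q x))
                              (Equivalence.to (P⇔Q x) ∘′ Equivalence.from (xs⇔ x))

Unique-map⁺-on : ∀ (f : A → B) {xs} → (∀ {a b} → a ∈ xs → b ∈ xs → f a ≡ f b → a ≡ b) →
                 Unique xs → Unique (map f xs)
Unique-map⁺-on f {[]}     _   []           = []
Unique-map⁺-on f {a ∷ xs} inj (a∉ ∷ uxs) =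
  All.tabulate fa≢ ∷ Unique-map⁺-on f (λ a∈ b∈ → inj (there a∈) (there b∈)) uxs
  where
  fa≢ : ∀ {v} → v ∈ map f xs → f a ≢ v
  fa≢ v∈ fa≡v with b , b∈ , refl ← ∈-map⁻ f v∈ = All.lookup a∉ b∈ (inj (here refl) (there b∈) fa≡v)

Unique-concatMap⁺ : ∀ (g : A → List B) {ks} → Unique ks → (∀ {k} → k ∈ ks → Unique (g k)) →
                    (∀ {k k′ v} → k ∈ ks → k′ ∈ ks → v ∈ g k → v ∈ g k′ → k ≡ k′) →
                    Unique (concatMap g ks)
Unique-concatMap⁺ g {[]}     _          _  _     = []
Unique-concatMap⁺ g {k ∷ ks} (k∉ ∷ uks) ug owner =
  Unique.++⁺ (ug (here refl))
             (Unique-concatMap⁺ g uks (ug ∘ there) λ k∈ k′∈ → owner (there k∈) (there k′∈))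
             disjoint
  where
  disjoint : ∀ {v} → ¬ (v ∈ g k × v ∈ concatMap g ks)
  disjoint (v∈gk , v∈rest) with k′ , k′∈ , v∈gk′ ← find (∈-concatMap⁻ g v∈rest) =
    All.lookup k∉ k′∈ (owner (here refl) (there k′∈) v∈gk v∈gk′)

length-concatMap : ∀ (g : A → List B) xs → length (concatMap g xs) ≡ sum (map (length ∘ g) xs)
length-concatMap g []       = refl
length-concatMap g (x ∷ xs) = trans (length-++ (g x)) (cong (_+_ (length (g x))) (length-concatMap g xs))

AllPairs-map-within : ∀ {P : A → Set} {R S : A → A → Set} {xs} → All P xs →
                      (∀ {a b} → P a → P b → R a b → S a b) → AllPairs R xs → AllPairs S xs
AllPairs-map-within []         _ []         = []
AllPairs-map-within (pa ∷ pxs) f (ra ∷ rxs) =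
  All.zipWith (λ (pb , rab) → f pa pb rab) (pxs , ra) ∷ AllPairs-map-within pxs f rxs

sum-map-++ : ∀ (h : A → ℕ) xs ys → sum (map h (xs ++ ys)) ≡ sum (map h xs) + sum (map h ys)
sum-map-++ h xs ys = trans (cong sum (map-++ h xs ys)) (sum-++ (map h xs) (map h ys))

sum-map-concatMap : ∀ (h : B → ℕ) (g : A → List B) xs → sum (map h (concatMap g xs)) ≡ sum (map (sum ∘ map h ∘ g) xs)
sum-map-concatMap h g []       = refl
sum-map-concatMap h g (x ∷ xs) =
  trans (sum-map-++ h (g x) (concatMap g xs)) (cong (_+_ (sum (map h (g x)))) (sum-map-concatMap h g xs))

copies : ℕ → List A → List A
copies n xs = concat (replicate n xs)

sum-map-copies : ∀ (h : A → ℕ) n xs → sum (map h (copies n xs)) ≡ n * sum (map h xs)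
sum-map-copies h zero    xs = refl
sum-map-copies h (suc n) xs =
  trans (sum-map-++ h xs (copies n xs)) (cong (_+_ (sum (map h xs))) (sum-map-copies h n xs))

sumℤ-++ : ∀ xs ys → sumℤ (xs ++ ys) ≡ sumℤ xs ℤ.+ sumℤ ys
sumℤ-++ []       ys = sym (ℤ.+-identityˡ _)
sumℤ-++ (v ∷ xs) ys = trans (cong (ℤ._+_ v) (sumℤ-++ xs ys)) (sym (ℤ.+-assoc v (sumℤ xs) (sumℤ ys)))

Cell : Set
Cell = ℕ × ℕ × ℕ

_≟ᶜ_ : DecidableEquality Cell
_≟ᶜ_ = ×-≡-dec _≟_ (×-≡-dec _≟_ _≟_)

open import Data.List.Membership.DecPropositional _≟ᶜ_ using (_∈?_)

layer : Cell → ℕ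
layer (_ , _ , l) = l

above : Cell → Cell
above (i , j , l) = (i , j , suc l)

slab : ℕ → List Cell
slab h = cartesianProduct (upTo 3) (cartesianProduct (upTo 3) (upTo h))

∈-slab⁺ : ∀ {i j l h} → i < 3 → j < 3 → l < h → (i , j , l) ∈ slab h
∈-slab⁺ i<3 j<3 l<h = ∈-cartesianProduct⁺ (∈-upTo⁺ i<3) (∈-cartesianProduct⁺ (∈-upTo⁺ j<3) (∈-upTo⁺ l<h))

∈-slab⁻ : ∀ {i j l h} → (i , j , l) ∈ slab h → i < 3 × j < 3 × l < h
∈-slab⁻ {h = h} p∈ with i∈ , jl∈ ← ∈-cartesianProduct⁻ (upTo 3) _ p∈
                    with j∈ , l∈ ← ∈-cartesianProduct⁻ (upTo 3) (upTo h) jl∈ =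
  ∈-upTo⁻ i∈ , ∈-upTo⁻ j∈ , ∈-upTo⁻ l∈

_∈ᶜ?_ : ∀ p c → Dec (p ∈ᶜ c)
(i , j , l) ∈ᶜ? c = (x c ≤? i ×-dec i <? x c + dx c) ×-dec
                    (y c ≤? j ×-dec j <? y c + dy c) ×-dec
                    (z c ≤? l ×-dec l <? z c + dz c)

Meet : ℕ → ℕ → ℕ → ℕ → Set
Meet a m b n = a ⊔ b < (a + m) ⊓ (b + n)

common⇒Meet : ∀ {a m b n i} → a ≤ i × i < a + m → b ≤ i × i < b + n → Meet a m b n
common⇒Meet (a≤i , i<a+m) (b≤i , i<b+n) = ≤-<-trans (⊔-lub a≤i b≤i) (⊓-glb i<a+m i<b+n)

Meet⇒common : ∀ {a m b n} → Meet a m b n → (a ≤ a ⊔ b × a ⊔ b < a + m) × (b ≤ a ⊔ b × a ⊔ b < b + n)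
Meet⇒common {a} {b = b} meet =
  (m≤m⊔n a b , <-≤-trans meet (m⊓n≤m _ _)) , (m≤n⊔m a b , <-≤-trans meet (m⊓n≤n _ _))

disjoint? : ∀ c d → Dec (Disjoint c d)
disjoint? c d = map′ no-common-cell meet-on-each-axis (¬? (meet? x dx ×-dec meet? y dy ×-dec meet? z dz))
  where
  meet? : (pos len : Cuboid → ℕ) → Dec (Meet (pos c) (len c) (pos d) (len d))
  meet? pos len = suc (pos c ⊔ pos d) ≤? (pos c + len c) ⊓ (pos d + len d)
  no-common-cell : ¬ (Meet (x c) (dx c) (x d) (dx d) × Meet (y c) (dy c) (y d) (dy d) × Meet (z c) (dz c) (z d) (dz d)) →
                   Disjoint c d
  no-common-cell ¬meet (_ , (xc , yc , zc) , (xd , yd , zd)) =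
    ¬meet (common⇒Meet xc xd , common⇒Meet yc yd , common⇒Meet zc zd)
  meet-on-each-axis : Disjoint c d →
                      ¬ (Meet (x c) (dx c) (x d) (dx d) × Meet (y c) (dy c) (y d) (dy d) × Meet (z c) (dz c) (z d) (dz d))
  meet-on-each-axis disj (mx , my , mz) with Meet⇒common mx | Meet⇒common my | Meet⇒common mz
  ... | xc , xd | yc , yd | zc , zd = disj (_ , (xc , yc , zc) , (xd , yd , zd))

Disjoint-sym : ∀ {c d} → Disjoint c d → Disjoint d c
Disjoint-sym c#d (p , p∈d , p∈c) = c#d (p , p∈c , p∈d)

Disjoint-members : ∀ {cs c d} → AllPairs Disjoint cs → c ∈ cs → d ∈ cs → c ≢ d → Disjoint c d
Disjoint-members (_  ∷ _)  (here refl) (here refl) c≢d = contradiction refl c≢d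
Disjoint-members (c# ∷ _)  (here refl) (there d∈)  _   = All.lookup c# d∈
Disjoint-members (d# ∷ _)  (there c∈)  (here refl) _   = Disjoint-sym (All.lookup d# c∈)
Disjoint-members (_  ∷ ds) (there c∈)  (there d∈)  c≢d = Disjoint-members ds c∈ d∈ c≢d

open SortingAlgorithm mergeSort using (sort; sort-↭; sort-↗)

Brick : Cuboid → Set
Brick = CongruentTo 1 2 3

sides : Cuboid → List ℕ
sides c = dx c ∷ dy c ∷ dz c ∷ []

1∷2∷3-sorted : Sorted≤ ≤-totalOrder (1 ∷ 2 ∷ 3 ∷ [])
1∷2∷3-sorted = s≤s z≤n ∷ s≤s (s≤s z≤n) ∷ [-]

brick? : ∀ c → Dec (Brick c)
brick? c = map′ sorted⇒brick brick⇒sorted (≡-dec _≟_ (sort (sides c)) (1 ∷ 2 ∷ 3 ∷ []))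
  where
  sorted⇒brick : sort (sides c) ≡ 1 ∷ 2 ∷ 3 ∷ [] → Brick c
  sorted⇒brick eq = subst (sides c ↭_) eq (↭-sym (sort-↭ (sides c)))
  brick⇒sorted : Brick c → sort (sides c) ≡ 1 ∷ 2 ∷ 3 ∷ []
  brick⇒sorted brick = Pointwise-≡⇒≡ (↗↭↗⇒≋ ≤-totalOrder (sort-↗ (sides c)) 1∷2∷3-sorted
                                        (↭⇒↭ₛ (↭-trans (sort-↭ (sides c)) brick)))

brick-side-bounds : ∀ {c d} → Brick c → d ∈ sides c → 1 ≤ d × d ≤ 3
brick-side-bounds brick d∈ with ∈-resp-↭ brick d∈
... | here refl                 = ≤-refl , s≤s z≤n
... | there (here refl)         = s≤s z≤n , s≤s (s≤s z≤n)
... | there (there (here refl)) = s≤s z≤n , ≤-refl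

Candidate : Cuboid → Set
Candidate c = z c ≡ 0 × Brick c × x c + dx c ≤ 3 × y c + dy c ≤ 3

candidate? : ∀ c → Dec (Candidate c)
candidate? c = z c ≟ 0 ×-dec brick? c ×-dec x c + dx c ≤? 3 ×-dec y c + dy c ≤? 3

floorCuboid : (ℕ × ℕ) × ℕ × ℕ × ℕ → Cuboid
floorCuboid ((a , b) , (p , q , r)) = cuboid a b 0 p q r

floorCuboids : List Cuboid
floorCuboids = map floorCuboid (cartesianProduct (cartesianProduct (upTo 3) (upTo 3))
                                                 (cartesianProduct (upTo 4) (cartesianProduct (upTo 4) (upTo 4))))

opaque
  candidates : List Cuboid
  candidates = filter candidate? floorCuboids

opaque
  unfolding candidates

  ∈-candidates⁻ : ∀ {c} → c ∈ candidates → Candidate c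
  ∈-candidates⁻ c∈ = proj₂ (∈-filter⁻ candidate? {xs = floorCuboids} c∈)

  ∈-candidates⁺ : ∀ {c} → Candidate c → c ∈ candidates
  ∈-candidates⁺ {cuboid a b _ p q r} cand@(refl , brick , a+p≤3 , b+q≤3) =
    ∈-filter⁺ candidate? (∈-map⁺ floorCuboid
      (∈-cartesianProduct⁺ (∈-cartesianProduct⁺ (∈-upTo⁺ (offset<3 a+p≤3 p-bounds)) (∈-upTo⁺ (offset<3 b+q≤3 q-bounds)))
                           (∈-cartesianProduct⁺ (∈-upTo⁺ (s≤s (proj₂ p-bounds)))
                             (∈-cartesianProduct⁺ (∈-upTo⁺ (s≤s (proj₂ q-bounds))) (∈-upTo⁺ (s≤s (proj₂ r-bounds)))))))
      cand
    where
    p-bounds : 1 ≤ p × p ≤ 3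
    p-bounds = brick-side-bounds {cuboid a b 0 p q r} brick (here refl)
    q-bounds : 1 ≤ q × q ≤ 3
    q-bounds = brick-side-bounds {cuboid a b 0 p q r} brick (there (here refl))
    r-bounds : 1 ≤ r × r ≤ 3
    r-bounds = brick-side-bounds {cuboid a b 0 p q r} brick (there (there (here refl)))
    offset<3 : ∀ {u v} → u + v ≤ 3 → 1 ≤ v × v ≤ 3 → u < 3
    offset<3 {u} u+v≤3 (1≤v , _) = <-≤-trans (m<m+n u 1≤v) u+v≤3

  candidates-sorted : Sorted candidates
  candidates-sorted = toWitness {a? = AllPairs.allPairs? _<ᶜ?_ candidates} tt

candidate-cell : ∀ {c i j l} → Candidate c → (i , j , l) ∈ᶜ c → i < 3 × j < 3 × l < 3
candidate-cell {cuboid a b _ p q r} (refl , brick , a+p≤3 , b+q≤3) ((_ , i<) , (_ , j<) , (_ , l<r)) =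
  <-≤-trans i< a+p≤3 , <-≤-trans j< b+q≤3 ,
  <-≤-trans l<r (proj₂ (brick-side-bounds {cuboid a b 0 p q r} brick (there (there (here refl)))))

-- States and floor configurations

State : Set
State = List Cell

Avoids : State → Cuboid → Set
Avoids s c = All (λ p → ¬ (p ∈ᶜ c)) s

Filled : State → List Cuboid → Cell → Set
Filled s C p = p ∈ s ⊎ Any (p ∈ᶜ_) C

filled? : ∀ s C p → Dec (Filled s C p)
filled? s C p = p ∈? s ⊎-dec Any.any? (p ∈ᶜ?_) C

CoversFloor : State → List Cuboid → Set
CoversFloor s C = All (Filled s C) (slab 1)

-- The filled cells of the next two layers, in the order of slab 2, so that
-- equal regions give equal states.
next : State → List Cuboid → State
next s C = filter (filled? s C ∘ above) (slab 2)

∈-next⁺ : ∀ {s C i j l} → i < 3 → j < 3 → l < 2 → Filled s C (i , j , suc l) → (i , j , l) ∈ next s C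
∈-next⁺ {s} {C} i<3 j<3 l<2 filled = ∈-filter⁺ (filled? s C ∘ above) (∈-slab⁺ i<3 j<3 l<2) filled

∈-next⁻ : ∀ {s C p} → p ∈ next s C → p ∈ slab 2 × Filled s C (above p)
∈-next⁻ {s} {C} = ∈-filter⁻ (filled? s C ∘ above) {xs = slab 2}

next⊆slab : ∀ {s C} → next s C ⊆ slab 2
next⊆slab {s} {C} p∈ = proj₁ (∈-next⁻ {s} {C} p∈)

Compatible : State → Cuboid → List Cuboid → Set
Compatible s c ds = Avoids s c × All (Disjoint c) ds

compatible? : ∀ s c ds → Dec (Compatible s c ds)
compatible? s c ds = All.all? (λ p → ¬? (p ∈ᶜ? c)) s ×-dec All.all? (disjoint? c) ds

extendPackings : State → Cuboid → List (List Cuboid) → List (List Cuboid)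
extendPackings s c ps = ps ++ map (c ∷_) (filter (compatible? s c) ps)

packings : State → List Cuboid → List (List Cuboid)
packings s []       = [ [] ]
packings s (c ∷ cs) = extendPackings s c (packings s cs)

coversFloor? : ∀ s C → Dec (CoversFloor s C)
coversFloor? s C = All.all? (filled? s C) (slab 1)

configurations : State → List (List Cuboid)
configurations s = filter (coversFloor? s) (packings s candidates)

record IsPacking (s : State) (C : List Cuboid) : Set where
  field
    sorted   : Sorted C
    disjoint : AllPairs Disjoint C
    avoids   : All (Avoids s) C

[]-isPacking : ∀ {s} → IsPacking s []
[]-isPacking = record { sorted = [] ; disjoint = [] ; avoids = [] }

[]∈packings : ∀ s cs → [] ∈ packings s cs
[]∈packings s []       = here refl
[]∈packings s (c ∷ cs) = ∈-++⁺ˡ ([]∈packings s cs)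

packings-sound : ∀ s cs → Sorted cs → ∀ {C} → C ∈ packings s cs → C ⊆ cs × IsPacking s C
packings-sound s []       _            (here refl) = (λ ()) , []-isPacking
packings-sound s (c ∷ cs) (c< ∷ scs) C∈ with ∈-++⁻ (packings s cs) C∈
... | inj₁ C∈′ with C⊆ , pC ← packings-sound s cs scs C∈′ = there ∘ C⊆ , pC
... | inj₂ C∈′ with D , D∈ , refl ← ∈-map⁻ (c ∷_) C∈′
               with D∈′ , avoid , c-disjoint ← ∈-filter⁻ (compatible? s c) D∈
               with D⊆ , pD ← packings-sound s cs scs D∈′ =
  (λ { (here e≡c) → here e≡c ; (there e∈) → there (D⊆ e∈) }) ,
  record { sorted   = All.tabulate (All.lookup c< ∘ D⊆) ∷ IsPacking.sorted pD
         ; disjoint = c-disjoint ∷ IsPacking.disjoint pD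
         ; avoids   = avoid ∷ IsPacking.avoids pD }

⊆-drop-smallest : ∀ {c cs d D} → All (c <ᶜ_) cs → d ∈ c ∷ cs → All (d <ᶜ_) D → D ⊆ c ∷ cs → D ⊆ cs
⊆-drop-smallest c< d∈ d< D⊆ e∈ with D⊆ e∈ | d∈
... | there e∈cs | _          = e∈cs
... | here refl  | here refl  = contradiction (All.lookup d< e∈) <ᶜ-irrefl
... | here refl  | there d∈cs = contradiction (<ᶜ-trans (All.lookup d< e∈) (All.lookup c< d∈cs)) <ᶜ-irrefl

packings-complete : ∀ s cs → Sorted cs → ∀ {C} → C ⊆ cs → IsPacking s C → C ∈ packings s cs
packings-complete s cs _ {[]} _ _ = []∈packings s cs
packings-complete s [] _ {d ∷ D} d∷D⊆ _ with () ← d∷D⊆ (here refl)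
packings-complete s (c ∷ cs) (c< ∷ scs) {d ∷ D} d∷D⊆ pC
  with record { sorted = d< ∷ sD ; disjoint = d-disjoint ∷ dD ; avoids = avoid ∷ aD } ← pC
  with d∷D⊆ (here refl)
... | here refl = ∈-++⁺ʳ (packings s cs) (∈-map⁺ (c ∷_) (∈-filter⁺ (compatible? s c) D∈ (avoid , d-disjoint)))
  where
  D∈ : D ∈ packings s cs
  D∈ = packings-complete s cs scs (⊆-drop-smallest c< (here refl) d< (d∷D⊆ ∘ there))
                         (record { sorted = sD ; disjoint = dD ; avoids = aD })
... | there d∈cs = ∈-++⁺ˡ (packings-complete s cs scs d∷D⊆′ pC)
  where
  d∷D⊆′ : d ∷ D ⊆ cs
  d∷D⊆′ (here refl) = d∈cs
  d∷D⊆′ (there e∈)  = ⊆-drop-smallest c< (there d∈cs) d< (d∷D⊆ ∘ there) e∈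

packings-unique : ∀ s cs → Sorted cs → Unique (packings s cs)
packings-unique s []       _            = [] ∷ []
packings-unique s (c ∷ cs) (c< ∷ scs) =
  Unique.++⁺ (packings-unique s cs scs)
             (Unique.map⁺ ∷-injectiveʳ (Unique.filter⁺ (compatible? s c) (packings-unique s cs scs)))
             c∉packings
  where
  c∉packings : ∀ {C} → ¬ (C ∈ packings s cs × C ∈ map (c ∷_) (filter (compatible? s c) (packings s cs)))
  c∉packings (C∈ , C∈′) with D , _ , refl ← ∈-map⁻ (c ∷_) C∈′ =
    <ᶜ-irrefl (All.lookup c< (proj₁ (packings-sound s cs scs C∈) (here refl)))

record IsConfiguration (s : State) (C : List Cuboid) : Set where
  field
    candidate : All Candidate C
    packing   : IsPacking s C
    covers    : CoversFloor s C

configurations-sound : ∀ {s C} → C ∈ configurations s → IsConfiguration s C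
configurations-sound {s} C∈ with C∈′ , covers ← ∈-filter⁻ (coversFloor? s) C∈
                            with C⊆ , pC ← packings-sound s candidates candidates-sorted C∈′ =
  record { candidate = All.tabulate (∈-candidates⁻ ∘ C⊆) ; packing = pC ; covers = covers }

configurations-complete : ∀ {s C} → IsConfiguration s C → C ∈ configurations s
configurations-complete {s} conf =
  ∈-filter⁺ (coversFloor? s)
            (packings-complete s candidates candidates-sorted (∈-candidates⁺ ∘ All.lookup candidate) packing)
            covers
  where open IsConfiguration conf

configurations-unique : ∀ s → Unique (configurations s)
configurations-unique s = Unique.filter⁺ (coversFloor? s) (packings-unique s candidates candidates-sorted)

up : Cuboid → Cuboid
up c = cuboid (x c) (y c) (suc (z c)) (dx c) (dy c) (dz c)

down : Cuboid → Cuboid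
down c = cuboid (x c) (y c) (pred (z c)) (dx c) (dy c) (dz c)

up-injective : ∀ {c d} → up c ≡ up d → c ≡ d
up-injective {cuboid _ _ _ _ _ _} {cuboid _ _ _ _ _ _} refl = refl

up∘down : ∀ {c} → z c ≢ 0 → up (down c) ≡ c
up∘down {cuboid _ _ zero    _ _ _} z≢0 = contradiction refl z≢0
up∘down {cuboid _ _ (suc _) _ _ _} _   = refl

up-<ᶜ : ∀ {c d} → c <ᶜ d → up c <ᶜ up d
up-<ᶜ (here p)                  = here p
up-<ᶜ (there (here p))          = there (here p)
up-<ᶜ (there (there (here p)))  = there (there (here (s<s p)))
up-<ᶜ (there (there (there p))) = there (there (there p))

up-<ᶜ⁻ : ∀ {c d} → up c <ᶜ up d → c <ᶜ d
up-<ᶜ⁻ (here p)                  = here p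
up-<ᶜ⁻ (there (here p))          = there (here p)
up-<ᶜ⁻ (there (there (here p)))  = there (there (here (s<s⁻¹ p)))
up-<ᶜ⁻ (there (there (there p))) = there (there (there p))

down-<ᶜ : ∀ {c d} → z c ≢ 0 → z d ≢ 0 → c <ᶜ d → down c <ᶜ down d
down-<ᶜ {c} {d} zc≢0 zd≢0 c<d = up-<ᶜ⁻ (subst₂ _<ᶜ_ (sym (up∘down zc≢0)) (sym (up∘down zd≢0)) c<d)

above-∈ᶜ-up : ∀ {p c} → p ∈ᶜ c → above p ∈ᶜ up c
above-∈ᶜ-up (i∈ , j∈ , (z≤l , l<)) = i∈ , j∈ , (s≤s z≤l , s<s l<)

∈ᶜ-up⁻ : ∀ {i j l c} → (i , j , l) ∈ᶜ up c → ∃[ l′ ] (l ≡ suc l′ × (i , j , l′) ∈ᶜ c)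
∈ᶜ-up⁻ {l = suc l′} (i∈ , j∈ , (s≤s z≤l , s<s l<)) = l′ , refl , i∈ , j∈ , (z≤l , l<)

∈ᶜ-down⁺ : ∀ {i j l c} → z c ≢ 0 → (i , j , suc l) ∈ᶜ c → (i , j , l) ∈ᶜ down c
∈ᶜ-down⁺ {c = cuboid _ _ zero    _ _ _} z≢0 _ = contradiction refl z≢0
∈ᶜ-down⁺ {c = cuboid _ _ (suc _) _ _ _} _   (i∈ , j∈ , (s≤s z≤l , s<s l<)) = i∈ , j∈ , (z≤l , l<)

∈ᶜ-down⁻ : ∀ {p c} → z c ≢ 0 → p ∈ᶜ down c → above p ∈ᶜ c
∈ᶜ-down⁻ z≢0 p∈ = subst (_ ∈ᶜ_) (up∘down z≢0) (above-∈ᶜ-up p∈)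

Disjoint-up : ∀ {c d} → Disjoint c d → Disjoint (up c) (up d)
Disjoint-up {c} {d} c#d (_ , p∈c , p∈d) with ∈ᶜ-up⁻ {c = c} p∈c | ∈ᶜ-up⁻ {c = d} p∈d
... | _ , refl , q∈c | _ , refl , q∈d = c#d (_ , q∈c , q∈d)

Disjoint-down : ∀ {c d} → z c ≢ 0 → z d ≢ 0 → Disjoint c d → Disjoint (down c) (down d)
Disjoint-down zc≢0 zd≢0 c#d (_ , p∈c , p∈d) = c#d (_ , ∈ᶜ-down⁻ zc≢0 p∈c , ∈ᶜ-down⁻ zd≢0 p∈d)

stack : List Cuboid → List Cuboid → List Cuboid
stack C ts = insertAll C (map up ts)

∈-stack⁻ : ∀ {e} C ts → e ∈ stack C ts → e ∈ C ⊎ ∃[ t ] (t ∈ ts × e ≡ up t)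
∈-stack⁻ C ts e∈ with ∈-insertAll⁻ C (map up ts) e∈
... | inj₁ e∈C  = inj₁ e∈C
... | inj₂ e∈ts = inj₂ (∈-map⁻ up e∈ts)

∈-stack⁺ˡ : ∀ {e} C ts → e ∈ C → e ∈ stack C ts
∈-stack⁺ˡ C ts = ∈-insertAll⁺ˡ C (map up ts)

∈-stack⁺ʳ : ∀ {t} C ts → t ∈ ts → up t ∈ stack C ts
∈-stack⁺ʳ C ts t∈ = ∈-insertAll⁺ʳ C (map up ts) (∈-map⁺ up t∈)

stack-sorted : ∀ C {ts} → Sorted ts → Sorted (stack C ts)
stack-sorted C sts = insertAll-sorted C _ (AllPairs.map⁺ (AllPairs.map up-<ᶜ sts))

Any-stack⁺ˡ : ∀ {P : Cuboid → Set} {C} ts → Any P C → Any P (stack C ts)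
Any-stack⁺ˡ {C = C} ts pC with c , c∈ , Pc ← find pC = lose (∈-stack⁺ˡ C ts c∈) Pc

floor-of-stack : ∀ {C ts e} → e ∈ stack C ts → z e ≡ 0 → e ∈ C
floor-of-stack {C} {ts} e∈ z≡0 with ∈-stack⁻ C ts e∈
... | inj₁ e∈C             = e∈C
... | inj₂ (t , _ , refl) = contradiction z≡0 λ ()

stack-injectiveˡ : ∀ {C C′ ts ts′} → Sorted C → Sorted C′ →
                   All (λ c → z c ≡ 0) C → All (λ c → z c ≡ 0) C′ →
                   stack C ts ≡ stack C′ ts′ → C ≡ C′
stack-injectiveˡ {C} {C′} {ts} {ts′} sC sC′ C-floor C′-floor eq =
  Sorted-≡ sC sC′ (λ e∈ → floor-of-stack (subst (_ ∈_) eq (∈-stack⁺ˡ C ts e∈)) (All.lookup C-floor e∈))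
                  (λ e∈ → floor-of-stack (subst (_ ∈_) (sym eq) (∈-stack⁺ˡ C′ ts′ e∈)) (All.lookup C′-floor e∈))

stack-injectiveʳ : ∀ {C ts ts′} → Sorted ts → Sorted ts′ → All (λ c → z c ≡ 0) C →
                   stack C ts ≡ stack C ts′ → ts ≡ ts′
stack-injectiveʳ {C} {ts} {ts′} sts sts′ C-floor eq =
  Sorted-≡ sts sts′ (raised-of-stack eq) (raised-of-stack (sym eq))
  where
  raised-of-stack : ∀ {us vs} → stack C us ≡ stack C vs → ∀ {t} → t ∈ us → t ∈ vs
  raised-of-stack {us} {vs} eq′ t∈ with ∈-stack⁻ C vs (subst (_ ∈_) eq′ (∈-stack⁺ʳ C us t∈))
  ... | inj₁ up-t∈C          = contradiction (All.lookup C-floor up-t∈C) λ ()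
  ... | inj₂ (t′ , t′∈ , eq″) = subst (_∈ vs) (sym (up-injective eq″)) t′∈

-- Peeling off the floor layer

record IsTilingMinus (L : ℕ) (s : State) (ts : List Cuboid) : Set where
  field
    sorted   : Sorted ts
    bricks   : All Brick ts
    inside   : All (InsideBox 3 3 L) ts
    disjoint : AllPairs Disjoint ts
    avoids   : All (Avoids s) ts
    covers   : ∀ {i j l} → i < 3 → j < 3 → l < L → (i , j , l) ∉ s → Any ((i , j , l) ∈ᶜ_) ts
    fits     : All ((_< L) ∘ layer) s

≤-suc-of-below : ∀ {n L} → (∀ {k} → suc k < n → k < L) → n ≤ suc L
≤-suc-of-below {zero}        _     = z≤n
≤-suc-of-below {suc zero}    _     = s≤s z≤n
≤-suc-of-below {suc (suc k)} below = s≤s (below ≤-refl)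

module Stacking {L s C ts} (s⊆ : s ⊆ slab 2) (conf : IsConfiguration s C)
                (tiling : IsTilingMinus L (next s C) ts) where
  open IsConfiguration conf
  module P = IsPacking packing
  module T = IsTilingMinus tiling

  trace-of-C : ∀ {c i j l} → c ∈ C → (i , j , suc l) ∈ᶜ c → (i , j , l) ∈ next s C
  trace-of-C c∈ p∈ with i<3 , j<3 , l+1<3 ← candidate-cell (All.lookup candidate c∈) p∈ =
    ∈-next⁺ {s} {C} i<3 j<3 (s<s⁻¹ l+1<3) (inj₂ (lose c∈ p∈))

  trace-of-s : ∀ {i j l} → (i , j , suc l) ∈ s → (i , j , l) ∈ next s C
  trace-of-s p∈ with i<3 , j<3 , l+1<2 ← ∈-slab⁻ (s⊆ p∈) =
    ∈-next⁺ {s} {C} i<3 j<3 (m<n⇒m<1+n (s<s⁻¹ l+1<2)) (inj₁ p∈)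

  not-traced : ∀ {i j l} → (i , j , suc l) ∉ s → ¬ Any ((i , j , suc l) ∈ᶜ_) C → (i , j , l) ∉ next s C
  not-traced p∉s p∉C q∈ = either p∉s p∉C (proj₂ (∈-next⁻ q∈))

  floor-brick-fits : ∀ {c} → c ∈ C → z c + dz c ≤ suc L
  floor-brick-fits {c@(cuboid a b _ p q r)} c∈ with refl , brick , _ ← All.lookup candidate c∈ =
    ≤-suc-of-below λ {k} k+1<r → All.lookup T.fits (trace-of-C c∈ (cell-at k+1<r))
    where
    cell-at : ∀ {l} → l < r → (a , b , l) ∈ᶜ c
    cell-at l<r = (≤-refl , m<m+n a (proj₁ (brick-side-bounds {c} brick (here refl)))) ,
                  (≤-refl , m<m+n b (proj₁ (brick-side-bounds {c} brick (there (here refl))))) ,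
                  (z≤n , l<r)

  floor-under-up : ∀ {c t} → c ∈ C → t ∈ ts → Disjoint c (up t)
  floor-under-up {c} {t} c∈ t∈ (_ , p∈c , p∈t) with _ , refl , q∈t ← ∈ᶜ-up⁻ {c = t} p∈t =
    All.lookup (All.lookup T.avoids t∈) (trace-of-C c∈ p∈c) q∈t

  up-avoids : ∀ {t} → t ∈ ts → Avoids s (up t)
  up-avoids {t} t∈ = All.tabulate not-in-up
    where
    not-in-up : ∀ {p} → p ∈ s → ¬ (p ∈ᶜ up t)
    not-in-up {_ , _ , _} p∈s p∈t with _ , refl , q∈t ← ∈ᶜ-up⁻ {c = t} p∈t =
      All.lookup (All.lookup T.avoids t∈) (trace-of-s p∈s) q∈t

  disjoint : ∀ {c d} → c ∈ stack C ts → d ∈ stack C ts → c <ᶜ d → Disjoint c d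
  disjoint c∈ d∈ c<d with ∈-stack⁻ C ts c∈ | ∈-stack⁻ C ts d∈
  ... | inj₁ c∈C              | inj₁ d∈C                = Disjoint-members P.disjoint c∈C d∈C (<ᶜ⇒≢ c<d)
  ... | inj₁ c∈C              | inj₂ (t , t∈ , refl)    = floor-under-up c∈C t∈
  ... | inj₂ (t , t∈ , refl)  | inj₁ d∈C                = Disjoint-sym (floor-under-up d∈C t∈)
  ... | inj₂ (t , t∈ , refl)  | inj₂ (t′ , t′∈ , refl)  =
    Disjoint-up (Disjoint-members T.disjoint t∈ t′∈ (<ᶜ⇒≢ (up-<ᶜ⁻ c<d)))

  covers′ : ∀ {i j l} → i < 3 → j < 3 → l < suc L → (i , j , l) ∉ s → Any ((i , j , l) ∈ᶜ_) (stack C ts)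
  covers′ {l = zero} i<3 j<3 _ p∉s with All.lookup covers (∈-slab⁺ {h = 1} i<3 j<3 z<s)
  ... | inj₁ p∈s = contradiction p∈s p∉s
  ... | inj₂ p∈C = Any-stack⁺ˡ ts p∈C
  covers′ {i} {j} {suc l} i<3 j<3 l+1<L+1 p∉s with Any.any? ((i , j , suc l) ∈ᶜ?_) C
  ... | yes p∈C = Any-stack⁺ˡ ts p∈C
  ... | no  p∉C with t , t∈ , q∈t ← find (T.covers i<3 j<3 (s<s⁻¹ l+1<L+1) (not-traced p∉s p∉C)) =
    lose (∈-stack⁺ʳ C ts t∈) (above-∈ᶜ-up q∈t)

  fits′ : ∀ {p} → p ∈ s → layer p < suc L
  fits′ {_ , _ , zero}  _   = z<s
  fits′ {_ , _ , suc l} p∈s = s<s (All.lookup T.fits (trace-of-s p∈s))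

  inside′ : ∀ {c} → c ∈ stack C ts → InsideBox 3 3 (suc L) c
  inside′ c∈ with ∈-stack⁻ C ts c∈
  ... | inj₁ c∈C with _ , _ , x+dx≤3 , y+dy≤3 ← All.lookup candidate c∈C =
    x+dx≤3 , y+dy≤3 , floor-brick-fits c∈C
  ... | inj₂ (t , t∈ , refl) with x+dx≤3 , y+dy≤3 , z+dz≤L ← All.lookup T.inside t∈ =
    x+dx≤3 , y+dy≤3 , s≤s z+dz≤L

  brick′ : ∀ {c} → c ∈ stack C ts → Brick c
  brick′ c∈ with ∈-stack⁻ C ts c∈
  ... | inj₁ c∈C             = proj₁ (proj₂ (All.lookup candidate c∈C))
  ... | inj₂ (t , t∈ , refl) = All.lookup T.bricks t∈

  avoids′ : ∀ {c} → c ∈ stack C ts → Avoids s c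
  avoids′ c∈ with ∈-stack⁻ C ts c∈
  ... | inj₁ c∈C             = All.lookup P.avoids c∈C
  ... | inj₂ (t , t∈ , refl) = up-avoids t∈

  isTilingMinus : IsTilingMinus (suc L) s (stack C ts)
  isTilingMinus = record
    { sorted   = stack-sorted C T.sorted
    ; bricks   = All.tabulate brick′
    ; inside   = All.tabulate inside′
    ; disjoint = Sorted⇒AllPairs (stack-sorted C T.sorted) disjoint
    ; avoids   = All.tabulate avoids′
    ; covers   = covers′
    ; fits     = All.tabulate fits′
    }

onFloor? : ∀ c → Dec (z c ≡ 0)
onFloor? c = z c ≟ 0

module Unstacking {L s ts} (s⊆ : s ⊆ slab 2) (tiling : IsTilingMinus (suc L) s ts) where
  module T = IsTilingMinus tiling

  floor : List Cuboid
  floor = filter onFloor? ts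

  raised : List Cuboid
  raised = filter (¬? ∘ onFloor?) ts

  rest : List Cuboid
  rest = map down raised

  ∈-floor⁻ : ∀ {c} → c ∈ floor → c ∈ ts × z c ≡ 0
  ∈-floor⁻ = ∈-filter⁻ onFloor?

  ∈-raised⁻ : ∀ {c} → c ∈ raised → c ∈ ts × z c ≢ 0
  ∈-raised⁻ = ∈-filter⁻ (¬? ∘ onFloor?)

  raised-off-floor : All (λ c → z c ≢ 0) raised
  raised-off-floor = All.all-filter (¬? ∘ onFloor?) ts

  candidate : ∀ {c} → c ∈ floor → Candidate c
  candidate c∈ with c∈ts , z≡0 ← ∈-floor⁻ c∈ with x+dx≤3 , y+dy≤3 , _ ← All.lookup T.inside c∈ts =
    z≡0 , All.lookup T.bricks c∈ts , x+dx≤3 , y+dy≤3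

  covers-floor : ∀ {p} → p ∈ slab 1 → Filled s floor p
  covers-floor {i , j , _} p∈ with i<3 , j<3 , s≤s z≤n ← ∈-slab⁻ {h = 1} p∈ with (i , j , 0) ∈? s
  ... | yes p∈s = inj₁ p∈s
  ... | no  p∉s with t , t∈ , p∈t ← find (T.covers i<3 j<3 z<s p∉s) =
    inj₂ (lose (∈-filter⁺ onFloor? t∈ (n≤0⇒n≡0 (proj₁ (proj₂ (proj₂ p∈t))))) p∈t)

  isConfiguration : IsConfiguration s floor
  isConfiguration = record
    { candidate = All.tabulate candidate
    ; packing   = record { sorted   = AllPairs.filter⁺ onFloor? T.sorted
                         ; disjoint = AllPairs.filter⁺ onFloor? T.disjoint
                         ; avoids   = All.filter⁺ onFloor? T.avoids }
    ; covers    = All.tabulate covers-floor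
    }

  avoids-next : ∀ {r} → r ∈ raised → Avoids (next s floor) (down r)
  avoids-next {r} r∈ = All.tabulate not-in-down
    where
    r∈ts : r ∈ ts
    r∈ts = proj₁ (∈-raised⁻ r∈)
    z≢0 : z r ≢ 0
    z≢0 = proj₂ (∈-raised⁻ r∈)
    not-in-down : ∀ {p} → p ∈ next s floor → ¬ (p ∈ᶜ down r)
    not-in-down p∈ p∈r with proj₂ (∈-next⁻ p∈)
    ... | inj₁ q∈s  = All.lookup (All.lookup T.avoids r∈ts) q∈s (∈ᶜ-down⁻ z≢0 p∈r)
    ... | inj₂ q∈floor with d , d∈ , q∈d ← find q∈floor with d∈ts , z≡0 ← ∈-floor⁻ d∈ =
      Disjoint-members T.disjoint d∈ts r∈ts (λ { refl → z≢0 z≡0 }) (_ , q∈d , ∈ᶜ-down⁻ z≢0 p∈r)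

  untraced : ∀ {i j l} → i < 3 → j < 3 → (i , j , l) ∉ next s floor → (i , j , suc l) ∉ s
  untraced i<3 j<3 p∉next q∈s with _ , _ , l+1<2 ← ∈-slab⁻ (s⊆ q∈s) =
    p∉next (∈-next⁺ i<3 j<3 (m<n⇒m<1+n (s<s⁻¹ l+1<2)) (inj₁ q∈s))

  covers-rest : ∀ {i j l} → i < 3 → j < 3 → l < L → (i , j , l) ∉ next s floor → Any ((i , j , l) ∈ᶜ_) rest
  covers-rest i<3 j<3 l<L p∉next with find (T.covers i<3 j<3 (s<s l<L) (untraced i<3 j<3 p∉next))
  ... | t , t∈ , q∈t with onFloor? t
  ...   | yes z≡0 with _ , _ , l+1<3 ← candidate-cell (candidate (∈-filter⁺ onFloor? t∈ z≡0)) q∈t =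
    contradiction (∈-next⁺ {s} {floor} i<3 j<3 (s<s⁻¹ l+1<3) (inj₂ (lose (∈-filter⁺ onFloor? t∈ z≡0) q∈t))) p∉next
  ...   | no  z≢0 = lose (∈-map⁺ down (∈-filter⁺ (¬? ∘ onFloor?) t∈ z≢0)) (∈ᶜ-down⁺ z≢0 q∈t)

  fits-next : ∀ {p} → p ∈ next s floor → layer p < L
  fits-next p∈ with proj₂ (∈-next⁻ p∈)
  ... | inj₁ q∈s     = s<s⁻¹ (All.lookup T.fits q∈s)
  ... | inj₂ q∈floor with d , d∈ , (_ , _ , (_ , l+1<)) ← find q∈floor =
    s<s⁻¹ (<-≤-trans l+1< (proj₂ (proj₂ (All.lookup T.inside (proj₁ (∈-floor⁻ d∈))))))

  inside-down : ∀ {c} → z c ≢ 0 → InsideBox 3 3 (suc L) c → InsideBox 3 3 L (down c)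
  inside-down {cuboid _ _ zero    _ _ _} z≢0 _                        = contradiction refl z≢0
  inside-down {cuboid _ _ (suc _) _ _ _} _   (x+dx≤3 , y+dy≤3 , s≤s z+dz≤L) = x+dx≤3 , y+dy≤3 , z+dz≤L

  isTilingMinus : IsTilingMinus L (next s floor) rest
  isTilingMinus = record
    { sorted   = rest-sorted
    ; bricks   = All.map⁺ (All.filter⁺ (¬? ∘ onFloor?) T.bricks)
    ; inside   = All.map⁺ (All.zipWith (λ {c} (z≢0 , in-box) → inside-down {c} z≢0 in-box)
                                       (raised-off-floor , All.filter⁺ (¬? ∘ onFloor?) T.inside))
    ; disjoint = AllPairs.map⁺ (AllPairs-map-within raised-off-floor Disjoint-down
                                                    (AllPairs.filter⁺ (¬? ∘ onFloor?) T.disjoint))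
    ; avoids   = All.map⁺ (All.tabulate avoids-next)
    ; covers   = covers-rest
    ; fits     = All.tabulate fits-next
    }
    where
    rest-sorted : Sorted rest
    rest-sorted = AllPairs.map⁺ (AllPairs-map-within raised-off-floor down-<ᶜ (AllPairs.filter⁺ (¬? ∘ onFloor?) T.sorted))

  restack : stack floor rest ≡ ts
  restack = Sorted-≡ (stack-sorted floor (IsTilingMinus.sorted isTilingMinus)) T.sorted from-stack to-stack
    where
    from-stack : ∀ {e} → e ∈ stack floor rest → e ∈ ts
    from-stack e∈ with ∈-stack⁻ floor rest e∈
    ... | inj₁ e∈floor = proj₁ (∈-floor⁻ e∈floor)
    ... | inj₂ (t , t∈ , refl) with r , r∈ , refl ← ∈-map⁻ down t∈ =
      subst (_∈ ts) (sym (up∘down (proj₂ (∈-raised⁻ r∈)))) (proj₁ (∈-raised⁻ r∈))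
    to-stack : ∀ {e} → e ∈ ts → e ∈ stack floor rest
    to-stack {e} e∈ with onFloor? e
    ... | yes z≡0 = ∈-stack⁺ˡ floor rest (∈-filter⁺ onFloor? e∈ z≡0)
    ... | no  z≢0 = subst (_∈ stack floor rest) (up∘down z≢0)
                          (∈-stack⁺ʳ floor rest (∈-map⁺ down (∈-filter⁺ (¬? ∘ onFloor?) e∈ z≢0)))

opaque
  tilingCount : ℕ → State → ℕ
  tilingCount zero    []      = 1
  tilingCount zero    (_ ∷ _) = 0
  tilingCount (suc L) s       = sum (map (tilingCount L ∘ next s) (configurations s))

  tilingCount-zero-[] : tilingCount 0 [] ≡ 1
  tilingCount-zero-[] = refl

  tilingCount-zero-∷ : ∀ p s → tilingCount 0 (p ∷ s) ≡ 0
  tilingCount-zero-∷ _ _ = refl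

  tilingCount-suc : ∀ L s → tilingCount (suc L) s ≡ sum (map (tilingCount L ∘ next s) (configurations s))
  tilingCount-suc _ _ = refl

HasCount-tilings-zero : ∀ s → HasCount (IsTilingMinus 0 s) (tilingCount 0 s)
HasCount-tilings-zero (p ∷ s) =
  [] , [] , sym (tilingCount-zero-∷ p s) ,
  λ _ → mk⇔ (λ tiling → contradiction (All.lookup (IsTilingMinus.fits tiling) (here refl)) λ ()) λ ()
HasCount-tilings-zero []      =
  [ [] ] , [] ∷ [] , sym tilingCount-zero-[] , λ _ → mk⇔ only-empty λ { (here refl) → empty-tiling }
  where
  empty-tiling : IsTilingMinus 0 [] []
  empty-tiling = record { sorted = [] ; bricks = [] ; inside = [] ; disjoint = [] ; avoids = []
                        ; covers = λ _ _ () ; fits = [] }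
  only-empty : ∀ {ts} → IsTilingMinus 0 [] ts → ts ∈ [ [] ]
  only-empty {[]}    _      = here refl
  only-empty {c ∷ _} tiling with _ , _ , z+dz≤0 ← All.lookup (IsTilingMinus.inside tiling) (here refl) =
    contradiction (≤-trans (proj₁ (brick-side-bounds {c} (All.lookup (IsTilingMinus.bricks tiling) (here refl))
                                                         (there (there (here refl)))))
                           (≤-trans (m≤n+m (dz c) (z c)) z+dz≤0))
                  λ ()

module AddFloorLayer {L} (count : ∀ s → s ⊆ slab 2 → HasCount (IsTilingMinus L s) (tilingCount L s))
                     (s : State) (s⊆ : s ⊆ slab 2) where

  tilingsAbove : List Cuboid → List (List Cuboid)
  tilingsAbove C = proj₁ (count (next s C) (next⊆slab {s} {C}))

  tilingsAbove-unique : ∀ C → Unique (tilingsAbove C)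
  tilingsAbove-unique C = proj₁ (proj₂ (count (next s C) (next⊆slab {s} {C})))

  tilingsAbove-length : ∀ C → length (tilingsAbove C) ≡ tilingCount L (next s C)
  tilingsAbove-length C = proj₁ (proj₂ (proj₂ (count (next s C) (next⊆slab {s} {C}))))

  ∈-tilingsAbove : ∀ C ts → IsTilingMinus L (next s C) ts ⇔ ts ∈ tilingsAbove C
  ∈-tilingsAbove C = proj₂ (proj₂ (proj₂ (count (next s C) (next⊆slab {s} {C}))))

  extensions : List Cuboid → List (List Cuboid)
  extensions C = map (stack C) (tilingsAbove C)

  tilings : List (List Cuboid)
  tilings = concatMap extensions (configurations s)

  on-floor : ∀ {C} → C ∈ configurations s → All (λ c → z c ≡ 0) C
  on-floor C∈ = All.map proj₁ (IsConfiguration.candidate (configurations-sound C∈))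

  sorted-configuration : ∀ {C} → C ∈ configurations s → Sorted C
  sorted-configuration C∈ = IsPacking.sorted (IsConfiguration.packing (configurations-sound C∈))

  sorted-above : ∀ {C ts} → ts ∈ tilingsAbove C → Sorted ts
  sorted-above {C} {ts} ts∈ = IsTilingMinus.sorted (Equivalence.from (∈-tilingsAbove C ts) ts∈)

  extensions-unique : ∀ {C} → C ∈ configurations s → Unique (extensions C)
  extensions-unique {C} C∈ =
    Unique-map⁺-on (stack C) (λ t∈ t′∈ → stack-injectiveʳ (sorted-above t∈) (sorted-above t′∈) (on-floor C∈))
                   (tilingsAbove-unique C)

  extension-owner : ∀ {C C′ ts} → C ∈ configurations s → C′ ∈ configurations s →
                    ts ∈ extensions C → ts ∈ extensions C′ → C ≡ C′
  extension-owner {C} {C′} C∈ C′∈ ts∈ ts∈′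
    with t , _ , refl ← ∈-map⁻ (stack C) ts∈ | t′ , _ , eq ← ∈-map⁻ (stack C′) ts∈′ =
    stack-injectiveˡ (sorted-configuration C∈) (sorted-configuration C′∈) (on-floor C∈) (on-floor C′∈) eq

  tilings-unique : Unique tilings
  tilings-unique = Unique-concatMap⁺ extensions (configurations-unique s) extensions-unique extension-owner

  tilings-length : length tilings ≡ tilingCount (suc L) s
  tilings-length = begin
    length tilings                                                 ≡⟨ length-concatMap extensions (configurations s) ⟩
    sum (map (length ∘ extensions) (configurations s))             ≡⟨ cong sum (map-cong extensions-length (configurations s)) ⟩
    sum (map (tilingCount L ∘ next s) (configurations s))          ≡⟨ tilingCount-suc L s ⟨
    tilingCount (suc L) s                                          ∎
    where
    open ≡-Reasoning
    extensions-length : ∀ C → length (extensions C) ≡ tilingCount L (next s C)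
    extensions-length C = trans (length-map (stack C) (tilingsAbove C)) (tilingsAbove-length C)

  ∈-tilings⁺ : ∀ {ts} → IsTilingMinus (suc L) s ts → ts ∈ tilings
  ∈-tilings⁺ tiling =
    subst (_∈ tilings) restack
          (∈-concatMap⁺ extensions (lose (configurations-complete isConfiguration)
                                         (∈-map⁺ (stack floor) (Equivalence.to (∈-tilingsAbove floor rest) isTilingMinus))))
    where open Unstacking s⊆ tiling

  ∈-tilings⁻ : ∀ {ts} → ts ∈ tilings → IsTilingMinus (suc L) s ts
  ∈-tilings⁻ ts∈ with C , C∈ , ts∈ext ← find (∈-concatMap⁻ extensions ts∈)
                 with t , t∈ , refl ← ∈-map⁻ (stack C) ts∈ext =
    Stacking.isTilingMinus s⊆ (configurations-sound C∈) (Equivalence.from (∈-tilingsAbove C t) t∈)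

  hasCount : HasCount (IsTilingMinus (suc L) s) (tilingCount (suc L) s)
  hasCount = tilings , tilings-unique , tilings-length , λ _ → mk⇔ ∈-tilings⁺ ∈-tilings⁻

tilingCount-correct : ∀ L s → s ⊆ slab 2 → HasCount (IsTilingMinus L s) (tilingCount L s)
tilingCount-correct zero    s _  = HasCount-tilings-zero s
tilingCount-correct (suc L) s s⊆ = AddFloorLayer.hasCount (tilingCount-correct L) s s⊆

-- The transfer system from the empty state

-- The states reachable from [] and, for each of them, the indices of next s C
-- for C in configurations s, in that order; transitions checks both tables.
states : List State
states =
  []
  ∷ ((0 , 2 , 0) ∷ (1 , 2 , 0) ∷ (2 , 2 , 0) ∷ [])
  ∷ ((0 , 0 , 0) ∷ (1 , 0 , 0) ∷ (2 , 0 , 0) ∷ [])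
  ∷ ((0 , 0 , 0) ∷ (0 , 1 , 0) ∷ (0 , 2 , 0) ∷ (1 , 0 , 0) ∷ (1 , 1 , 0) ∷ (1 , 2 , 0) ∷ (2 , 0 , 0) ∷ (2 , 1 , 0) ∷ (2 , 2 , 0) ∷ [])
  ∷ ((0 , 0 , 0) ∷ (0 , 1 , 0) ∷ (0 , 1 , 1) ∷ (0 , 2 , 0) ∷ (0 , 2 , 1) ∷ (1 , 0 , 0) ∷ (1 , 1 , 0) ∷ (1 , 1 , 1) ∷ (1 , 2 , 0) ∷ (1 , 2 , 1) ∷ (2 , 0 , 0) ∷ (2 , 1 , 0) ∷ (2 , 1 , 1) ∷ (2 , 2 , 0) ∷ (2 , 2 , 1) ∷ [])
  ∷ ((2 , 0 , 0) ∷ (2 , 1 , 0) ∷ (2 , 2 , 0) ∷ [])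
  ∷ ((0 , 0 , 0) ∷ (0 , 0 , 1) ∷ (0 , 1 , 0) ∷ (0 , 1 , 1) ∷ (0 , 2 , 0) ∷ (1 , 0 , 0) ∷ (1 , 0 , 1) ∷ (1 , 1 , 0) ∷ (1 , 1 , 1) ∷ (1 , 2 , 0) ∷ (2 , 0 , 0) ∷ (2 , 0 , 1) ∷ (2 , 1 , 0) ∷ (2 , 1 , 1) ∷ (2 , 2 , 0) ∷ [])
  ∷ ((0 , 0 , 0) ∷ (0 , 0 , 1) ∷ (0 , 1 , 0) ∷ (0 , 1 , 1) ∷ (0 , 2 , 0) ∷ (0 , 2 , 1) ∷ (1 , 0 , 0) ∷ (1 , 0 , 1) ∷ (1 , 1 , 0) ∷ (1 , 1 , 1) ∷ (1 , 2 , 0) ∷ (1 , 2 , 1) ∷ (2 , 0 , 0) ∷ (2 , 1 , 0) ∷ (2 , 2 , 0) ∷ [])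
  ∷ ((0 , 0 , 0) ∷ (0 , 1 , 0) ∷ (0 , 2 , 0) ∷ [])
  ∷ ((0 , 0 , 0) ∷ (0 , 1 , 0) ∷ (0 , 2 , 0) ∷ (1 , 0 , 0) ∷ (1 , 0 , 1) ∷ (1 , 1 , 0) ∷ (1 , 1 , 1) ∷ (1 , 2 , 0) ∷ (1 , 2 , 1) ∷ (2 , 0 , 0) ∷ (2 , 0 , 1) ∷ (2 , 1 , 0) ∷ (2 , 1 , 1) ∷ (2 , 2 , 0) ∷ (2 , 2 , 1) ∷ [])
  ∷ ((0 , 0 , 0) ∷ (0 , 1 , 0) ∷ (1 , 0 , 0) ∷ (1 , 1 , 0) ∷ (2 , 0 , 0) ∷ (2 , 1 , 0) ∷ [])
  ∷ ((0 , 0 , 0) ∷ (0 , 0 , 1) ∷ (0 , 1 , 0) ∷ (0 , 1 , 1) ∷ (1 , 0 , 0) ∷ (1 , 0 , 1) ∷ (1 , 1 , 0) ∷ (1 , 1 , 1) ∷ (2 , 0 , 0) ∷ (2 , 0 , 1) ∷ (2 , 1 , 0) ∷ (2 , 1 , 1) ∷ [])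
  ∷ ((0 , 1 , 0) ∷ (0 , 2 , 0) ∷ (1 , 1 , 0) ∷ (1 , 2 , 0) ∷ (2 , 1 , 0) ∷ (2 , 2 , 0) ∷ [])
  ∷ ((0 , 1 , 0) ∷ (0 , 1 , 1) ∷ (0 , 2 , 0) ∷ (0 , 2 , 1) ∷ (1 , 1 , 0) ∷ (1 , 1 , 1) ∷ (1 , 2 , 0) ∷ (1 , 2 , 1) ∷ (2 , 1 , 0) ∷ (2 , 1 , 1) ∷ (2 , 2 , 0) ∷ (2 , 2 , 1) ∷ [])
  ∷ ((0 , 0 , 0) ∷ (0 , 0 , 1) ∷ (0 , 1 , 0) ∷ (0 , 1 , 1) ∷ (0 , 2 , 0) ∷ (0 , 2 , 1) ∷ (1 , 0 , 0) ∷ (1 , 0 , 1) ∷ (1 , 1 , 0) ∷ (1 , 1 , 1) ∷ (1 , 2 , 0) ∷ (1 , 2 , 1) ∷ [])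
  ∷ ((0 , 0 , 0) ∷ (0 , 1 , 0) ∷ (0 , 2 , 0) ∷ (1 , 0 , 0) ∷ (1 , 1 , 0) ∷ (1 , 2 , 0) ∷ [])
  ∷ ((1 , 0 , 0) ∷ (1 , 0 , 1) ∷ (1 , 1 , 0) ∷ (1 , 1 , 1) ∷ (1 , 2 , 0) ∷ (1 , 2 , 1) ∷ (2 , 0 , 0) ∷ (2 , 0 , 1) ∷ (2 , 1 , 0) ∷ (2 , 1 , 1) ∷ (2 , 2 , 0) ∷ (2 , 2 , 1) ∷ [])
  ∷ ((1 , 0 , 0) ∷ (1 , 1 , 0) ∷ (1 , 2 , 0) ∷ (2 , 0 , 0) ∷ (2 , 1 , 0) ∷ (2 , 2 , 0) ∷ [])
  ∷ []

successorTable : List (List ℕ)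
successorTable =
  (1 ∷ 2 ∷ 3 ∷ 4 ∷ 4 ∷ 4 ∷ 5 ∷ 6 ∷ 7 ∷ 7 ∷ 8 ∷ 9 ∷ 9 ∷ 3 ∷ 9 ∷ 6 ∷ 6 ∷ 7 ∷ [])
  ∷ (0 ∷ 10 ∷ 11 ∷ 11 ∷ 11 ∷ [])
  ∷ (0 ∷ 12 ∷ 13 ∷ 13 ∷ 13 ∷ [])
  ∷ (0 ∷ [])
  ∷ (12 ∷ [])
  ∷ (0 ∷ 14 ∷ 14 ∷ 15 ∷ 14 ∷ [])
  ∷ (10 ∷ [])
  ∷ (15 ∷ [])
  ∷ (0 ∷ 16 ∷ 16 ∷ 17 ∷ 16 ∷ [])
  ∷ (17 ∷ [])
  ∷ (1 ∷ [])
  ∷ (3 ∷ [])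
  ∷ (2 ∷ [])
  ∷ (3 ∷ [])
  ∷ (3 ∷ [])
  ∷ (5 ∷ [])
  ∷ (3 ∷ [])
  ∷ (8 ∷ [])
  ∷ []

state : ℕ → State
state i = fromMaybe [] (head (drop i states))

successors : ℕ → List ℕ
successors i = fromMaybe [] (head (drop i successorTable))

transition? : ∀ i → Dec (map (next (state i)) (configurations (state i)) ≡ map state (successors i))
transition? i = ≡-dec (≡-dec _≟ᶜ_) (map (next (state i)) (configurations (state i))) (map state (successors i))

opaque
  unfolding candidates

  transitions-checked : T (all (isYes ∘ transition?) (upTo 18))
  transitions-checked = tt

transitions : ∀ {i} → i < 18 → map (next (state i)) (configurations (state i)) ≡ map state (successors i)
transitions {i} i<18 =
  toWitness {a? = transition? i}
            (All.lookup (All.all⁺ (isYes ∘ transition?) (upTo 18) transitions-checked) (∈-upTo⁺ i<18))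

successors-in-range : ∀ {i} → i < 18 → All (_< 18) (successors i)
successors-in-range i<18 =
  All.lookup (toWitness {a? = All.all? (All.all? (_<? 18) ∘ successors) (upTo 18)} tt) (∈-upTo⁺ i<18)

walks : ℕ → ℕ → List ℕ
walks zero    i = [ i ]
walks (suc k) i = concatMap (walks k) (successors i)

tilingCount-step : ∀ L {i} → i < 18 → tilingCount (suc L) (state i) ≡ sum (map (tilingCount L ∘ state) (successors i))
tilingCount-step L {i} i<18 = begin
  tilingCount (suc L) (state i)                                               ≡⟨ tilingCount-suc L (state i) ⟩
  sum (map (tilingCount L ∘ next (state i)) (configurations (state i)))       ≡⟨ cong sum (map-∘ (configurations (state i))) ⟩
  sum (map (tilingCount L) (map (next (state i)) (configurations (state i)))) ≡⟨ cong (sum ∘ map (tilingCount L)) (transitions i<18) ⟩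
  sum (map (tilingCount L) (map state (successors i)))                        ≡⟨ cong sum (map-∘ (successors i)) ⟨
  sum (map (tilingCount L ∘ state) (successors i))                            ∎
  where open ≡-Reasoning

tilingCount-walks : ∀ k L {i} → i < 18 → tilingCount (k + L) (state i) ≡ sum (map (tilingCount L ∘ state) (walks k i))
tilingCount-walks zero    L _        = sym (+-identityʳ _)
tilingCount-walks (suc k) L {i} i<18 = begin
  tilingCount (suc (k + L)) (state i)                                    ≡⟨ tilingCount-step (k + L) i<18 ⟩
  sum (map (tilingCount (k + L) ∘ state) (successors i))
                  ≡⟨ cong sum (map-cong-local (All.map (tilingCount-walks k L) (successors-in-range i<18))) ⟩
  sum (map (sum ∘ map (tilingCount L ∘ state) ∘ walks k) (successors i))
                  ≡⟨ sum-map-concatMap (tilingCount L ∘ state) (walks k) (successors i) ⟨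
  sum (map (tilingCount L ∘ state) (walks (suc k) i))                    ∎
  where open ≡-Reasoning

walks-from-empty : walks 6 0 ↭ copies 7 (walks 4 0) ++ copies 22 (walks 2 0) ++ copies 36 (walks 0 0)
walks-from-empty =
  ↭-trans (↭-sym (sort-↭ (walks 6 0))) (subst (_↭ combination) (sym sorted-equal) (sort-↭ combination))
  where
  combination : List ℕ
  combination = copies 7 (walks 4 0) ++ copies 22 (walks 2 0) ++ copies 36 (walks 0 0)
  sorted-equal : sort (walks 6 0) ≡ sort combination
  sorted-equal = toWitness {a? = ≡-dec _≟_ (sort (walks 6 0)) (sort combination)} tt

recurrence-cong : ∀ {a b c a′ b′ c′} → a ≡ a′ → b ≡ b′ → c ≡ c′ →
                  7 * a + 22 * b + 36 * c ≡ 7 * a′ + 22 * b′ + 36 * c′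
recurrence-cong refl refl refl = refl

sum-map-combination : ∀ (h : A → ℕ) xs ys zs →
                      sum (map h (copies 7 xs ++ copies 22 ys ++ copies 36 zs)) ≡
                      7 * sum (map h xs) + 22 * sum (map h ys) + 36 * sum (map h zs)
sum-map-combination {A = A} h xs ys zs = begin
  weight (copies 7 xs ++ copies 22 ys ++ copies 36 zs)
    ≡⟨ sum-map-++ h (copies 7 xs) (copies 22 ys ++ copies 36 zs) ⟩
  weight (copies 7 xs) + weight (copies 22 ys ++ copies 36 zs)
    ≡⟨ cong (_+_ (weight (copies 7 xs))) (sum-map-++ h (copies 22 ys) (copies 36 zs)) ⟩
  weight (copies 7 xs) + (weight (copies 22 ys) + weight (copies 36 zs))
    ≡⟨ +-assoc (weight (copies 7 xs)) (weight (copies 22 ys)) (weight (copies 36 zs)) ⟨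
  weight (copies 7 xs) + weight (copies 22 ys) + weight (copies 36 zs)
    ≡⟨ cong₂ _+_ (cong₂ _+_ (sum-map-copies h 7 xs) (sum-map-copies h 22 ys)) (sum-map-copies h 36 zs) ⟩
  7 * weight xs + 22 * weight ys + 36 * weight zs
    ∎
  where
  open ≡-Reasoning
  weight : List A → ℕ
  weight = sum ∘ map h

tilingCount-recurrence : ∀ L → tilingCount (6 + L) [] ≡
                         7 * tilingCount (4 + L) [] + 22 * tilingCount (2 + L) [] + 36 * tilingCount L []
tilingCount-recurrence L = begin
  tilingCount (6 + L) []
    ≡⟨ tilingCount-walks 6 L z<s ⟩
  weight (walks 6 0)
    ≡⟨ sum-↭ (↭.map⁺ h walks-from-empty) ⟩
  weight (copies 7 (walks 4 0) ++ copies 22 (walks 2 0) ++ copies 36 (walks 0 0))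
    ≡⟨ sum-map-combination h (walks 4 0) (walks 2 0) (walks 0 0) ⟩
  7 * weight (walks 4 0) + 22 * weight (walks 2 0) + 36 * weight (walks 0 0)
    ≡⟨ recurrence-cong (tilingCount-walks 4 L z<s) (tilingCount-walks 2 L z<s) (tilingCount-walks 0 L z<s) ⟨
  7 * tilingCount (4 + L) [] + 22 * tilingCount (2 + L) [] + 36 * tilingCount L []
    ∎
  where
  open ≡-Reasoning
  h : ℕ → ℕ
  h = tilingCount L ∘ state
  weight : List ℕ → ℕ
  weight = sum ∘ map h

opaque
  unfolding tilingCount

  walks-2-to-empty : sum (map (tilingCount 0 ∘ state) (walks 2 0)) ≡ 6
  walks-2-to-empty = refl

  walks-4-to-empty : sum (map (tilingCount 0 ∘ state) (walks 4 0)) ≡ 64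
  walks-4-to-empty = refl

tilingCount-2 : tilingCount 2 [] ≡ 6
tilingCount-2 = trans (tilingCount-walks 2 0 z<s) walks-2-to-empty

tilingCount-4 : tilingCount 4 [] ≡ 64
tilingCount-4 = trans (tilingCount-walks 4 0 z<s) walks-4-to-empty

tilingCount-6 : tilingCount 6 [] ≡ 616
tilingCount-6 = trans (tilingCount-recurrence 0) (recurrence-cong tilingCount-4 tilingCount-2 tilingCount-zero-[])

tilingCount-8 : tilingCount 8 [] ≡ 5936
tilingCount-8 = trans (tilingCount-recurrence 2) (recurrence-cong tilingCount-6 tilingCount-4 tilingCount-2)

-- The generating function

IsTilingMinus-empty⇔IsTiling : ∀ {L ts} → IsTilingMinus L [] ts ⇔ IsTiling 3 3 L 1 2 3 ts
IsTilingMinus-empty⇔IsTiling = mk⇔ to from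
  where
  to : ∀ {L ts} → IsTilingMinus L [] ts → IsTiling 3 3 L 1 2 3 ts
  to tiling = sorted , bricks , inside , disjoint , λ i j l i<3 j<3 l<L → covers i<3 j<3 l<L λ ()
    where open IsTilingMinus tiling
  from : ∀ {L ts} → IsTiling 3 3 L 1 2 3 ts → IsTilingMinus L [] ts
  from (sorted , bricks , inside , disjoint , covers) = record
    { sorted = sorted ; bricks = bricks ; inside = inside ; disjoint = disjoint
    ; avoids = All.universal (λ _ → []) _ ; covers = λ i<3 j<3 l<L _ → covers _ _ _ i<3 j<3 l<L ; fits = [] }

numTilings : ∀ L → NumTilings 3 3 L 1 2 3 (tilingCount L [])
numTilings L = HasCount-resp-⇔ (λ _ → IsTilingMinus-empty⇔IsTiling) (tilingCount-correct L [] λ ())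

denominator numerator : Series
denominator = poly (+ 1 ∷ + 0 ∷ + 0 ∷ - (+ 7) ∷ + 0 ∷ + 0 ∷ - (+ 22) ∷ + 0 ∷ + 0 ∷ - (+ 36) ∷ [])
numerator   = poly (+ 1 ∷ + 0 ∷ + 0 ∷ - (+ 1) ∷ [])

⋆-cong-≤ : ∀ p {f g : Series} n → (∀ {k} → k ≤ n → f k ≡ g k) → (p ⋆ f) n ≡ (p ⋆ g) n
⋆-cong-≤ p n f≡g = cong sumℤ (map-cong (λ i → cong (p i ℤ.*_) (f≡g (m∸n≤m n i))) (upTo (suc n)))

sumℤ-upTo-vanishing : ∀ (g : ℕ → ℤ) d j → (∀ i → g (d + i) ≡ + 0) →
                      sumℤ (map g (upTo (d + j))) ≡ sumℤ (map g (upTo d))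
sumℤ-upTo-vanishing g d zero    _      = cong (sumℤ ∘ map g ∘ upTo) (+-identityʳ d)
sumℤ-upTo-vanishing g d (suc j) g-zero = begin
  sumℤ (map g (upTo (d + suc j)))                   ≡⟨ cong (sumℤ ∘ map g ∘ upTo) (+-suc d j) ⟩
  sumℤ (map g (applyUpTo (λ i → i) (suc (d + j))))   ≡⟨ cong (sumℤ ∘ map g) (applyUpTo-∷ʳ (λ i → i) (d + j)) ⟨
  sumℤ (map g (upTo (d + j) ++ [ d + j ]))           ≡⟨ cong sumℤ (map-++ g (upTo (d + j)) [ d + j ]) ⟩
  sumℤ (map g (upTo (d + j)) ++ [ g (d + j) ])       ≡⟨ sumℤ-++ (map g (upTo (d + j))) [ g (d + j) ] ⟩
  sumℤ (map g (upTo (d + j))) ℤ.+ (g (d + j) ℤ.+ + 0) ≡⟨ cong (λ v → sumℤ (map g (upTo (d + j))) ℤ.+ (v ℤ.+ + 0))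
                                                             (g-zero j) ⟩
  sumℤ (map g (upTo (d + j))) ℤ.+ + 0               ≡⟨ ℤ.+-identityʳ _ ⟩
  sumℤ (map g (upTo (d + j)))                       ≡⟨ sumℤ-upTo-vanishing g d j g-zero ⟩
  sumℤ (map g (upTo d))                             ∎
  where open ≡-Reasoning

-- The denominator has degree 9, so only ten terms of the Cauchy sum survive.
denominator-⋆-tail : ∀ f j → (denominator ⋆ f) (9 + j) ≡
                     f (9 + j) ℤ.- (+ 7 ℤ.* f (6 + j) ℤ.+ + 22 ℤ.* f (3 + j) ℤ.+ + 36 ℤ.* f j)
denominator-⋆-tail f j =
  trans (sumℤ-upTo-vanishing (λ i → denominator i ℤ.* f (9 + j ∸ i)) 10 j (λ _ → refl))
        (solve 10 (λ x₉ x₈ x₇ x₆ x₅ x₄ x₃ x₂ x₁ x₀ →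
                     con (+ 1) :* x₉ :+ (con (+ 0) :* x₈ :+ (con (+ 0) :* x₇ :+ (con (- (+ 7)) :* x₆ :+
                     (con (+ 0) :* x₅ :+ (con (+ 0) :* x₄ :+ (con (- (+ 22)) :* x₃ :+ (con (+ 0) :* x₂ :+
                     (con (+ 0) :* x₁ :+ (con (- (+ 36)) :* x₀ :+ con (+ 0))))))))))
                     := x₉ :- (con (+ 7) :* x₆ :+ con (+ 22) :* x₃ :+ con (+ 36) :* x₀))
               refl (f (9 + j)) (f (8 + j)) (f (7 + j)) (f (6 + j)) (f (5 + j))
                    (f (4 + j)) (f (3 + j)) (f (2 + j)) (f (1 + j)) (f j))
  where open +-*-Solver

initial : ℕ → ℕ
initial 0 = 1
initial 3 = 6
initial 6 = 64
initial _ = 0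

series-head : All (λ n → (denominator ⋆ ofℕ initial) n ≡ numerator n) (upTo 9)
series-head = toWitness {a? = All.all? (λ n → (denominator ⋆ ofℕ initial) n ℤ.≟ numerator n) (upTo 9)} tt

module Coefficients (a : ℕ → ℕ) (a₀ : a 0 ≡ 1) (a-off : ∀ N → ¬ (3 ∣ N) → a N ≡ 0)
                    (a-tilings : ∀ m → NumTilings 3 3 (2 * suc m) 1 2 3 (a (3 * suc m))) where

  a-triple : ∀ q → a (q * 3) ≡ tilingCount (q * 2) []
  a-triple zero    = trans a₀ (sym tilingCount-zero-[])
  a-triple (suc m) = begin
    a (suc m * 3)                   ≡⟨ cong a (*-comm (suc m) 3) ⟩
    a (3 * suc m)                   ≡⟨ HasCount-unique (a-tilings m) (numTilings (2 * suc m)) ⟩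
    tilingCount (2 * suc m) []      ≡⟨ cong (λ L → tilingCount L []) (*-comm 2 (suc m)) ⟩
    tilingCount (suc m * 2) []      ∎
    where open ≡-Reasoning

  a-off-by : ∀ k j → ¬ (3 ∣ j) → a (k * 3 + j) ≡ 0
  a-off-by k j 3∤j = a-off (k * 3 + j) λ 3∣ → 3∤j (∣m+n∣m⇒∣n 3∣ (divides k refl))

  a-recurrence : ∀ j → a (9 + j) ≡ 7 * a (6 + j) + 22 * a (3 + j) + 36 * a j
  a-recurrence j with 3 ∣? j
  ... | yes (divides r refl) = begin
    a ((3 + r) * 3)                                                                ≡⟨ a-triple (3 + r) ⟩
    tilingCount (6 + r * 2) []                                                     ≡⟨ tilingCount-recurrence (r * 2) ⟩
    7 * tilingCount (4 + r * 2) [] + 22 * tilingCount (2 + r * 2) [] + 36 * tilingCount (r * 2) []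
                                          ≡⟨ recurrence-cong (a-triple (2 + r)) (a-triple (1 + r)) (a-triple r) ⟨
    7 * a ((2 + r) * 3) + 22 * a ((1 + r) * 3) + 36 * a (r * 3)                     ∎
    where open ≡-Reasoning
  ... | no 3∤j = begin
    a (3 * 3 + j)                                              ≡⟨ a-off-by 3 j 3∤j ⟩
    0                                                          ≡⟨ recurrence-cong (a-off-by 2 j 3∤j) (a-off-by 1 j 3∤j) (a-off-by 0 j 3∤j) ⟨
    7 * a (2 * 3 + j) + 22 * a (1 * 3 + j) + 36 * a (0 * 3 + j) ∎
    where open ≡-Reasoning

  a-initial : All (λ k → a k ≡ initial k) (upTo 9)
  a-initial = a₀ ∷ off 1 ∷ off 2 ∷ trans (a-triple 1) tilingCount-2 ∷ off 4 ∷ off 5 ∷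
              trans (a-triple 2) tilingCount-4 ∷ off 7 ∷ off 8 ∷ []
    where
    off : ∀ k {3∤k : True (¬? (3 ∣? k))} → a k ≡ 0
    off k {3∤k} = a-off k (toWitness 3∤k)

  series-tail : ∀ j → (denominator ⋆ ofℕ a) (9 + j) ≡ + 0
  series-tail j = begin
    (denominator ⋆ ofℕ a) (9 + j)             ≡⟨ denominator-⋆-tail (ofℕ a) j ⟩
    + a (9 + j) ℤ.- combination               ≡⟨ cong (ℤ._- combination) ofℕ-recurrence ⟩
    combination ℤ.- combination               ≡⟨ ℤ.+-inverseʳ combination ⟩
    + 0                                       ∎
    where
    open ≡-Reasoning
    combination : ℤ
    combination = + 7 ℤ.* + a (6 + j) ℤ.+ + 22 ℤ.* + a (3 + j) ℤ.+ + 36 ℤ.* + a j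
    ofℕ-recurrence : + a (9 + j) ≡ combination
    ofℕ-recurrence = trans (cong +_ (a-recurrence j))
      (trans (ℤ.pos-+ (7 * a (6 + j) + 22 * a (3 + j)) (36 * a j))
             (cong₂ ℤ._+_ (trans (ℤ.pos-+ (7 * a (6 + j)) (22 * a (3 + j)))
                                 (cong₂ ℤ._+_ (ℤ.pos-* 7 (a (6 + j))) (ℤ.pos-* 22 (a (3 + j)))))
                          (ℤ.pos-* 36 (a j))))

  series : ∀ n → (denominator ⋆ ofℕ a) n ≡ numerator n
  series n with n <? 9
  ... | yes n<9 = trans (⋆-cong-≤ denominator n (λ k≤n → cong +_ (All.lookup a-initial (∈-upTo⁺ (≤-<-trans k≤n n<9)))))
                        (All.lookup series-head (∈-upTo⁺ n<9))
  ... | no  n≮9 = subst (λ m → (denominator ⋆ ofℕ a) m ≡ numerator m) (m+[n∸m]≡n (≮⇒≥ n≮9)) (series-tail (n ∸ 9))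

mainTheorem19 : (a : ℕ → ℕ) →
  a 0 ≡ 1 →
  ((N : ℕ) → ¬ (3 ∣ N) → a N ≡ 0) →
  ((m : ℕ) → NumTilings 3 3 (2 * suc m) 1 2 3 (a (3 * suc m))) →
  ((n : ℕ) →
    (poly (+ 1 ∷ + 0 ∷ + 0 ∷ - (+ 7) ∷ + 0 ∷ + 0 ∷ - (+ 22) ∷ + 0 ∷ + 0 ∷ - (+ 36) ∷ []) ⋆ ofℕ a) n
      ≡ poly (+ 1 ∷ + 0 ∷ + 0 ∷ - (+ 1) ∷ []) n)
  × a 0 ≡ 1 × a 3 ≡ 6 × a 6 ≡ 64 × a 9 ≡ 616 × a 12 ≡ 5936
mainTheorem19 a a₀ a-off a-tilings =
  series , a₀ , trans (a-triple 1) tilingCount-2 , trans (a-triple 2) tilingCount-4 ,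
  trans (a-triple 3) tilingCount-6 , trans (a-triple 4) tilingCount-8
  where open Coefficients a a₀ a-off a-tilings
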